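{- For every countable ordinal $\alpha$, the relation $\sim_\alpha$ is definable in linear orders by a $\Sigma_{2\alpha}$ formula of $L_{\omega_1\omega}$ (in the language of linear orders).
   Context: Infinitary formulas: a formula is $\Sigma_0$ iff it is $\Pi_0$ iff it is finitary quantifier-free; for countable $\alpha>0$, a $\Sigma_\alpha$ formula is a countable disjunction $\bigvee_i\exists\bar x\,\varphi_i(\bar x)$ with each $\varphi_i$ $\Pi_\beta$ for some $\beta<\alpha$, and a $\Pi_\alpha$ formula is a countable conjunction $\bigwedge_i\forall\bar x\,\varphi_i(\bar x)$ with each $\varphi_i$ $\Sigma_\beta$ for some $\beta<\alpha$. For a linear order $L$ and $x,y\in L$: $x\sim_0 y$ iff $x=y$; $x\sim_1 y$ iff the interval $[x,y]$ or $[y,x]$ is finite; for $\alpha=\beta+1$, $x\sim_\alpha y$ iff $[x]_{\sim_\beta}\sim_1[y]_{\sim_\beta}$ in the quotient order $L/{\sim_\beta}$; for limit $\alpha$, $x\sim_\alpha y$ iff $x\sim_\beta y$ for some $\beta<\alpha$. -}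

module Defs where

open import Level using (Level; _⊔_; Lift; Setω) renaming (suc to lsuc; zero to lzero)
open import Data.Nat using (ℕ; _+_) renaming (zero to nzero; suc to nsuc)
open import Data.Fin using (Fin) renaming (zero to fzero; suc to fsuc)
open import Data.Product using (Σ; Σ-syntax; _×_; _,_)
open import Data.Sum using (_⊎_)
open import Data.Empty using (⊥)
open import Data.Unit using (⊤)
open import Data.List using (List)
open import Data.List.Relation.Unary.Any using (Any)
open import Relation.Binary.PropositionalEquality using (_≡_)
open import Relation.Binary.Bundles using (StrictTotalOrder)
open import Function.Bundles using (_⇔_)
open import Axiom.ExcludedMiddle using (ExcludedMiddle)

-- Countable ordinals as (well-formed) Brouwer trees

data Tree : Set where
  zero : Tree
  suc  : Tree → Tree
  lim  : (ℕ → Tree) → Tree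

-- the standard (Kraus–Nordvall Forsberg–Xu) order on Brouwer trees
data _≤ᵀ_ : Tree → Tree → Set where
  ≤-zero     : ∀ {x} → zero ≤ᵀ x
  ≤-trans    : ∀ {x y z} → x ≤ᵀ y → y ≤ᵀ z → x ≤ᵀ z
  ≤-succ     : ∀ {x y} → x ≤ᵀ y → suc x ≤ᵀ suc y
  ≤-cocone   : ∀ {x f} (k : ℕ) → x ≤ᵀ f k → x ≤ᵀ lim f
  ≤-limiting : ∀ {x f} → (∀ k → f k ≤ᵀ x) → lim f ≤ᵀ x

_<ᵀ_ : Tree → Tree → Set
x <ᵀ y = suc x ≤ᵀ y

-- well-formed trees: limits are taken of strictly increasing sequences;
-- these represent exactly the countable ordinals
data WF : Tree → Set where
  wf-zero : WF zero
  wf-suc  : ∀ {x} → WF x → WF (suc x)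
  wf-lim  : ∀ {f} → (∀ k → WF (f k)) → (∀ k → f k <ᵀ f (nsuc k)) → WF (lim f)

double : Tree → Tree
double zero    = zero
double (suc a) = suc (suc (double a))
double (lim f) = lim (λ k → double (f k))

-- Infinitary formulas of L_{ω₁ω} in the language {<} (with equality),
-- with n free variables (de Bruijn, Fin n)

data Formula (n : ℕ) : Set where
  eq lt  : Fin n → Fin n → Formula n
  tt ff  : Formula n
  neg    : Formula n → Formula n
  and or : Formula n → Formula n → Formula n
  ⋁ ⋀    : (ℕ → Formula n) → Formula n
  ex all : Formula (nsuc n) → Formula n

exs : ∀ {n} (k : ℕ) → Formula (k + n) → Formula n
exs nzero    φ = φ
exs (nsuc k) φ = exs k (ex φ)

alls : ∀ {n} (k : ℕ) → Formula (k + n) → Formula n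
alls nzero    φ = φ
alls (nsuc k) φ = alls k (all φ)

data QF {n : ℕ} : Formula n → Set where
  qf-eq  : ∀ i j → QF (eq i j)
  qf-lt  : ∀ i j → QF (lt i j)
  qf-tt  : QF tt
  qf-ff  : QF ff
  qf-neg : ∀ {φ} → QF φ → QF (neg φ)
  qf-and : ∀ {φ ψ} → QF φ → QF ψ → QF (and φ ψ)
  qf-or  : ∀ {φ ψ} → QF φ → QF ψ → QF (or φ ψ)

mutual
  data IsΣ {n : ℕ} : Tree → Formula n → Set where
    Σ-qf : ∀ {φ} → QF φ → IsΣ zero φ
    Σ-⋁  : ∀ {α} (f : ℕ → Formula n) →
           (∀ i → Σ[ k ∈ ℕ ] Σ[ ψ ∈ Formula (k + n) ] Σ[ β ∈ Tree ]
                    (f i ≡ exs k ψ × WF β × β <ᵀ α × IsΠ β ψ)) →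
           IsΣ α (⋁ f)

  data IsΠ {n : ℕ} : Tree → Formula n → Set where
    Π-qf : ∀ {φ} → QF φ → IsΠ zero φ
    Π-⋀  : ∀ {α} (f : ℕ → Formula n) →
           (∀ i → Σ[ k ∈ ℕ ] Σ[ ψ ∈ Formula (k + n) ] Σ[ β ∈ Tree ]
                    (f i ≡ alls k ψ × WF β × β <ᵀ α × IsΣ β ψ)) →
           IsΠ α (⋀ f)

module _ {c ℓ₁ ℓ₂ : Level} (L : StrictTotalOrder c ℓ₁ ℓ₂) where
  open StrictTotalOrder L renaming (Carrier to A)

  _∷ₑ_ : ∀ {n} → A → (Fin n → A) → Fin (nsuc n) → A
  (a ∷ₑ ρ) fzero    = a
  (a ∷ₑ ρ) (fsuc i) = ρ i

  Sat : ∀ {n} → Formula n → (Fin n → A) → Set (c ⊔ ℓ₁ ⊔ ℓ₂)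
  Sat (eq i j)  ρ = Lift (c ⊔ ℓ₂) (ρ i ≈ ρ j)
  Sat (lt i j)  ρ = Lift (c ⊔ ℓ₁) (ρ i < ρ j)
  Sat tt        ρ = Lift _ ⊤
  Sat ff        ρ = Lift _ ⊥
  Sat (neg φ)   ρ = Sat φ ρ → ⊥
  Sat (and φ ψ) ρ = Sat φ ρ × Sat ψ ρ
  Sat (or φ ψ)  ρ = Sat φ ρ ⊎ Sat ψ ρ
  Sat (⋁ f)     ρ = Σ[ i ∈ ℕ ] Sat (f i) ρ
  Sat (⋀ f)     ρ = ∀ i → Sat (f i) ρ
  Sat (ex φ)    ρ = Σ[ a ∈ A ] Sat φ (a ∷ₑ ρ)
  Sat (all φ)   ρ = ∀ a → Sat φ (a ∷ₑ ρ)

  _≤ᴸ_ : A → A → Set (ℓ₁ ⊔ ℓ₂)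
  x ≤ᴸ y = x < y ⊎ x ≈ y

  Between : A → A → A → Set (ℓ₁ ⊔ ℓ₂)
  Between x y z = (x ≤ᴸ z × z ≤ᴸ y) ⊎ (y ≤ᴸ z × z ≤ᴸ x)

  -- For α = β+1: the interval between [x] and [y] in L/∼_β is
  -- finite, i.e. the ∼_β-classes of the points between x and y are
  -- finitely many (covered by the classes of a finite list).
  Sim : Tree → A → A → Set (c ⊔ ℓ₁ ⊔ ℓ₂)
  Sim zero    x y = Lift (c ⊔ ℓ₂) (x ≈ y)
  Sim (suc β) x y = Σ[ zs ∈ List A ] (∀ z → Between x y z → Any (λ w → Sim β z w) zs)
  Sim (lim f) x y = Σ[ k ∈ ℕ ] Sim (f k) x y

env₂ : ∀ {a} {A : Set a} → A → A → Fin 2 → A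
env₂ x y fzero        = x
env₂ x y (fsuc fzero) = y

Defines : Tree → Formula 2 → Setω
Defines α φ = ∀ {c ℓ₁ ℓ₂} (L : StrictTotalOrder c ℓ₁ ℓ₂) →
              ExcludedMiddle (c ⊔ ℓ₁ ⊔ ℓ₂) →
              ∀ x y → Sat L φ (env₂ x y) ⇔ Sim L α x y

record DefinableBy (γ α : Tree) : Setω where
  field
    φ        : Formula 2
    φ-is-Σ   : IsΣ γ φ
    φ-defines : Defines α φ

{-# OPTIONS --safe #-}
-- At a limit, x ∼_α y iff x ∼_{αₖ} y for some k, and the disjuncts of all the φ_{αₖ}
-- merge into one countable disjunction.  At a successor β + 1, the interval between
-- [x] and [y] in L/∼_β is finite iff finitely many points v₀ … vₙ₋₁ meet every ∼_β-class
-- of a point between x and y: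
--   ⋁ₙ ∃v₀ … vₙ₋₁ ∀z (z ∉ [x, y] ∨ ⋁_{j<n} φ_β(z, vⱼ)).
-- Σ_{2β} is closed under finite disjunction and under disjunction with quantifier-free
-- formulas, so the ∀z-clause is Π_{2β+1} and the whole formula Σ_{2β+2}.  Excluded middle
-- is needed only to read the implication z ∈ [x, y] → … as that disjunction.

module Submission where

open import Defs
open import Level using (Level; _⊔_; Lift; lower)
open import Axiom.ExcludedMiddle using (ExcludedMiddle)
open import Data.Nat using (ℕ; zero; suc; _+_)
open import Data.Nat.Properties using (+-suc; +-identityʳ)
open import Data.Nat.DivMod using (_mod_; m<n⇒m%n≡m)
open import Data.Fin using (Fin; toℕ; lift; _↑ˡ_; _↑ʳ_) renaming (zero to fzero; suc to fsuc)
open import Data.Fin.Properties using (toℕ-injective; toℕ-fromℕ<; toℕ<n; ⊎⇔∃)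
open import Data.List using (length; lookup; tabulate)
open import Data.List.Relation.Unary.Any using (index)
open import Data.List.Relation.Unary.Any.Properties using (lookup-index; tabulate⁺)
open import Data.Product using (Σ; Σ-syntax; ∃; _×_; _,_; proj₂; uncurry)
open import Data.Product.Function.NonDependent.Propositional using (_×-⇔_)
open import Data.Sum using (_⊎_; inj₁; inj₂)
open import Data.Sum.Function.Propositional using (_⊎-⇔_)
open import Function using (_∘_)
open import Function.Bundles using (_⇔_; mk⇔; Equivalence)
open import Function.Construct.Composition using (_⇔-∘_)
open import Function.Construct.Identity using (⇔-id)
open import Function.Construct.Symmetry using (⇔-sym)
open import Function.Definitions using (StrictlySurjective)
open import Function.Related.Propositional using (equivalence; module EquationalReasoning)
open import Function.Related.TypeIsomorphisms using (¬-cong-⇔; →-cong-⇔; Σ-assoc)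
open import Relation.Binary.Bundles using (StrictTotalOrder)
open import Relation.Binary.PropositionalEquality using (_≡_; refl; sym; trans; cong; subst; subst₂)
open import Relation.Nullary using (¬_; Dec; yes; no; contradiction)

open Equivalence using (to; from)

private variable
  a b ℓ : Level
  I B : Set a
  n m : ℕ
  γ δ : Tree
  φ : Formula 2

Lift-⇔ : Lift ℓ B ⇔ B
Lift-⇔ = mk⇔ lower Level.lift

Σ-cong-⇔ : {P : I → Set a} {Q : I → Set b} → (∀ x → P x ⇔ Q x) → Σ I P ⇔ Σ I Q
Σ-cong-⇔ P⇔Q = mk⇔ (λ (x , p) → x , to (P⇔Q x) p) (λ (x , q) → x , from (P⇔Q x) q)

Π-cong-⇔ : {P : I → Set a} {Q : I → Set b} → (∀ x → P x ⇔ Q x) → (∀ x → P x) ⇔ (∀ x → Q x)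
Π-cong-⇔ P⇔Q = mk⇔ (λ p x → to (P⇔Q x) (p x)) (λ q x → from (P⇔Q x) (q x))

¬⊎⇔→ : {P : Set a} {Q : Set b} → Dec P → (¬ P ⊎ Q) ⇔ (P → Q)
¬⊎⇔→ P? = mk⇔ (λ { (inj₁ ¬p) p → contradiction p ¬p ; (inj₂ q) _ → q }) (decide P?)
  where
  decide : ∀ {P Q} → Dec P → (P → Q) → ¬ P ⊎ Q
  decide (yes p) p→q = inj₂ (p→q p)
  decide (no ¬p) _   = inj₁ ¬p

≤ᵀ-refl : ∀ x → x ≤ᵀ x
≤ᵀ-refl zero    = ≤-zero
≤ᵀ-refl (suc x) = ≤-succ (≤ᵀ-refl x)
≤ᵀ-refl (lim f) = ≤-limiting λ k → ≤-cocone k (≤ᵀ-refl (f k))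

≤ᵀ-suc : ∀ x → x ≤ᵀ suc x
≤ᵀ-suc zero    = ≤-zero
≤ᵀ-suc (suc x) = ≤-succ (≤ᵀ-suc x)
≤ᵀ-suc (lim f) = ≤-limiting λ k → ≤-trans (≤ᵀ-suc (f k)) (≤-succ (≤-cocone k (≤ᵀ-refl (f k))))

double-mono-≤ᵀ : ∀ {x y} → x ≤ᵀ y → double x ≤ᵀ double y
double-mono-≤ᵀ ≤-zero           = ≤-zero
double-mono-≤ᵀ (≤-trans x≤y y≤z) = ≤-trans (double-mono-≤ᵀ x≤y) (double-mono-≤ᵀ y≤z)
double-mono-≤ᵀ (≤-succ x≤y)      = ≤-succ (≤-succ (double-mono-≤ᵀ x≤y))
double-mono-≤ᵀ (≤-cocone k x≤fk) = ≤-cocone k (double-mono-≤ᵀ x≤fk)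
double-mono-≤ᵀ (≤-limiting f≤x)  = ≤-limiting λ k → double-mono-≤ᵀ (f≤x k)

double-mono-<ᵀ : ∀ {x y} → x <ᵀ y → double x <ᵀ double y
double-mono-<ᵀ {x} x<y = ≤-trans (≤-succ (≤ᵀ-suc (double x))) (double-mono-≤ᵀ x<y)

WF-double : ∀ {x} → WF x → WF (double x)
WF-double wf-zero          = wf-zero
WF-double (wf-suc w)       = wf-suc (wf-suc (WF-double w))
WF-double (wf-lim w f-inc) = wf-lim (λ k → WF-double (w k)) (λ k → double-mono-<ᵀ (f-inc k))

WF-lim-positive : ∀ {f} → WF (lim f) → zero <ᵀ lim f
WF-lim-positive (wf-lim _ f-inc) =
  ≤-trans (≤-succ ≤-zero) (≤-trans (f-inc 0) (≤-cocone 1 (≤ᵀ-refl _)))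

-- Cantor's enumeration of ℕ × ℕ, running through each anti-diagonal from (0 , d) to (d , 0).
next : ℕ × ℕ → ℕ × ℕ
next (a , suc b) = suc a , b
next (a , zero)  = zero , suc a

unpair : ℕ → ℕ × ℕ
unpair zero    = 0 , 0
unpair (suc m) = next (unpair m)

unpair-along-diagonal : ∀ a b {m} → unpair m ≡ (0 , a + b) → unpair (a + m) ≡ (a , b)
unpair-along-diagonal zero    b hit = hit
unpair-along-diagonal (suc a) b hit =
  cong next (unpair-along-diagonal a (suc b) (trans hit (cong (0 ,_) (sym (+-suc a b)))))

unpair-diagonal-start : ∀ d → ∃ λ m → unpair m ≡ (0 , d)
unpair-diagonal-start zero    = 0 , refl
unpair-diagonal-start (suc d) =
  let m , hit = unpair-diagonal-start d
  in  suc (d + m) ,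
      cong next (unpair-along-diagonal d 0 (trans hit (cong (0 ,_) (sym (+-identityʳ d)))))

unpair-surjective : StrictlySurjective _≡_ unpair
unpair-surjective (a , b) =
  let m , hit = unpair-diagonal-start (a + b) in a + m , unpair-along-diagonal a b hit

toℕ-mod : (j : Fin (suc n)) → toℕ j mod suc n ≡ j
toℕ-mod j = toℕ-injective (trans (toℕ-fromℕ< _) (m<n⇒m%n≡m (toℕ<n j)))

enumFin×ℕ : ℕ → Fin (suc n) × ℕ
enumFin×ℕ {n} m = let a , b = unpair m in a mod suc n , b

enumFin×ℕ-surjective : StrictlySurjective _≡_ (enumFin×ℕ {n})
enumFin×ℕ-surjective (j , b) =
  let m , m↦jb = unpair-surjective (toℕ j , b)
  in  m , trans (cong (λ (a , b) → a mod _ , b) m↦jb) (cong (_, b) (toℕ-mod j))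

liftUnder : ∀ k → (Fin n → Fin m) → Fin (k + n) → Fin (k + m)
liftUnder zero    ρ = ρ
liftUnder (suc k) ρ = lift 1 (liftUnder k ρ)

ren : (Fin n → Fin m) → Formula n → Formula m
ren ρ (eq i j)  = eq (ρ i) (ρ j)
ren ρ (lt i j)  = lt (ρ i) (ρ j)
ren ρ tt        = tt
ren ρ ff        = ff
ren ρ (neg φ)   = neg (ren ρ φ)
ren ρ (and φ ψ) = and (ren ρ φ) (ren ρ ψ)
ren ρ (or φ ψ)  = or (ren ρ φ) (ren ρ ψ)
ren ρ (⋁ f)     = ⋁ λ i → ren ρ (f i)
ren ρ (⋀ f)     = ⋀ λ i → ren ρ (f i)
ren ρ (ex φ)    = ex (ren (liftUnder 1 ρ) φ)
ren ρ (all φ)   = all (ren (liftUnder 1 ρ) φ)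

ren-exs : ∀ k (ρ : Fin n → Fin m) (ψ : Formula (k + n)) → ren ρ (exs k ψ) ≡ exs k (ren (liftUnder k ρ) ψ)
ren-exs zero    ρ ψ = refl
ren-exs (suc k) ρ ψ = ren-exs k ρ (ex ψ)

ren-alls : ∀ k (ρ : Fin n → Fin m) (ψ : Formula (k + n)) → ren ρ (alls k ψ) ≡ alls k (ren (liftUnder k ρ) ψ)
ren-alls zero    ρ ψ = refl
ren-alls (suc k) ρ ψ = ren-alls k ρ (all ψ)

QF-ren : ∀ (ρ : Fin n → Fin m) {φ} → QF φ → QF (ren ρ φ)
QF-ren ρ (qf-eq i j)   = qf-eq (ρ i) (ρ j)
QF-ren ρ (qf-lt i j)   = qf-lt (ρ i) (ρ j)
QF-ren ρ qf-tt         = qf-tt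
QF-ren ρ qf-ff         = qf-ff
QF-ren ρ (qf-neg q)    = qf-neg (QF-ren ρ q)
QF-ren ρ (qf-and q q′) = qf-and (QF-ren ρ q) (QF-ren ρ q′)
QF-ren ρ (qf-or q q′)  = qf-or (QF-ren ρ q) (QF-ren ρ q′)

ΣDisjunct : Tree → Formula n → Set
ΣDisjunct {n} α φ = Σ[ k ∈ ℕ ] Σ[ ψ ∈ Formula (k + n) ] Σ[ β ∈ Tree ] (φ ≡ exs k ψ × WF β × β <ᵀ α × IsΠ β ψ)

ΠConjunct : Tree → Formula n → Set
ΠConjunct {n} α φ = Σ[ k ∈ ℕ ] Σ[ ψ ∈ Formula (k + n) ] Σ[ β ∈ Tree ] (φ ≡ alls k ψ × WF β × β <ᵀ α × IsΣ β ψ)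

mutual
  IsΣ-ren : (ρ : Fin n → Fin m) {φ : Formula n} → IsΣ γ φ → IsΣ γ (ren ρ φ)
  IsΣ-ren ρ (Σ-qf q)  = Σ-qf (QF-ren ρ q)
  IsΣ-ren ρ (Σ-⋁ f d) = Σ-⋁ _ λ i → ΣDisjunct-ren ρ (d i)

  IsΠ-ren : (ρ : Fin n → Fin m) {φ : Formula n} → IsΠ γ φ → IsΠ γ (ren ρ φ)
  IsΠ-ren ρ (Π-qf q)  = Π-qf (QF-ren ρ q)
  IsΠ-ren ρ (Π-⋀ f c) = Π-⋀ _ λ i → ΠConjunct-ren ρ (c i)

  ΣDisjunct-ren : (ρ : Fin n → Fin m) {φ : Formula n} → ΣDisjunct γ φ → ΣDisjunct γ (ren ρ φ)
  ΣDisjunct-ren ρ (k , ψ , β , refl , wfβ , β<γ , ψ-Π) =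
    k , ren (liftUnder k ρ) ψ , β , ren-exs k ρ ψ , wfβ , β<γ , IsΠ-ren (liftUnder k ρ) ψ-Π

  ΠConjunct-ren : (ρ : Fin n → Fin m) {φ : Formula n} → ΠConjunct γ φ → ΠConjunct γ (ren ρ φ)
  ΠConjunct-ren ρ (k , ψ , β , refl , wfβ , β<γ , ψ-Σ) =
    k , ren (liftUnder k ρ) ψ , β , ren-alls k ρ ψ , wfβ , β<γ , IsΣ-ren (liftUnder k ρ) ψ-Σ

ΣDisjunct-qf : {φ : Formula n} → zero <ᵀ γ → QF φ → ΣDisjunct γ φ
ΣDisjunct-qf 0<γ q = 0 , _ , zero , refl , wf-zero , 0<γ , Π-qf q

ΣDisjunct-mono : {φ : Formula n} → γ ≤ᵀ δ → ΣDisjunct γ φ → ΣDisjunct δ φ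
ΣDisjunct-mono γ≤δ (k , ψ , β , e , wfβ , β<γ , ψ-Π) = k , ψ , β , e , wfβ , ≤-trans β<γ γ≤δ , ψ-Π

ΣDisjunct-positive : {φ : Formula n} → ΣDisjunct γ φ → zero <ᵀ γ
ΣDisjunct-positive (_ , _ , _ , _ , _ , β<γ , _) = ≤-trans (≤-succ ≤-zero) β<γ

disjuncts : {φ : Formula n} → IsΣ γ φ → ℕ → Formula n
disjuncts {φ = φ} (Σ-qf _) _ = φ
disjuncts (Σ-⋁ f _)          = f

disjuncts-ΣDisjunct : {φ : Formula n} → zero <ᵀ δ → γ ≤ᵀ δ →
                      (φ-Σ : IsΣ γ φ) → ∀ i → ΣDisjunct δ (disjuncts φ-Σ i)
disjuncts-ΣDisjunct 0<δ γ≤δ (Σ-qf q)  i = ΣDisjunct-qf 0<δ q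
disjuncts-ΣDisjunct 0<δ γ≤δ (Σ-⋁ f d) i = ΣDisjunct-mono γ≤δ (d i)

leq : Fin n → Fin n → Formula n
leq i j = or (lt i j) (eq i j)

between : Fin n → Fin n → Fin n → Formula n
between i j k = or (and (leq i k) (leq k j)) (and (leq j k) (leq k i))

QF-between : ∀ (i j k : Fin n) → QF (between i j k)
QF-between i j k = qf-or (qf-and (QF-leq i k) (QF-leq k j)) (qf-and (QF-leq j k) (QF-leq k i))
  where
  QF-leq : ∀ (i j : Fin n) → QF (leq i j)
  QF-leq i j = qf-or (qf-lt i j) (qf-eq i j)

⋁ᶠ : (Fin n → Formula m) → Formula m
⋁ᶠ {zero}  g = ff
⋁ᶠ {suc n} g = or (g fzero) (⋁ᶠ (g ∘ fsuc))

QF-⋁ᶠ : (g : Fin n → Formula m) → (∀ j → QF (g j)) → QF (⋁ᶠ g)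
QF-⋁ᶠ {zero}  g g-QF = qf-ff
QF-⋁ᶠ {suc n} g g-QF = qf-or (g-QF fzero) (QF-⋁ᶠ (g ∘ fsuc) (g-QF ∘ fsuc))

module Semantics {c ℓ₁ ℓ₂} (L : StrictTotalOrder c ℓ₁ ℓ₂) where
  open StrictTotalOrder L renaming (Carrier to A)

  ∷ₑ-liftUnder : ∀ {ρ : Fin n → Fin m} {e e′} a → (∀ i → e (ρ i) ≡ e′ i) →
                 ∀ i → _∷ₑ_ L a e (liftUnder 1 ρ i) ≡ _∷ₑ_ L a e′ i
  ∷ₑ-liftUnder a ρ-e fzero    = refl
  ∷ₑ-liftUnder a ρ-e (fsuc i) = ρ-e i

  Sat-ren : ∀ (ρ : Fin n → Fin m) φ {e : Fin m → A} {e′ : Fin n → A} →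
            (∀ i → e (ρ i) ≡ e′ i) → Sat L (ren ρ φ) e ⇔ Sat L φ e′
  Sat-ren ρ (eq i j)  ρ-e rewrite ρ-e i | ρ-e j = ⇔-id _
  Sat-ren ρ (lt i j)  ρ-e rewrite ρ-e i | ρ-e j = ⇔-id _
  Sat-ren ρ tt        ρ-e = ⇔-id _
  Sat-ren ρ ff        ρ-e = ⇔-id _
  Sat-ren ρ (neg φ)   ρ-e = ¬-cong-⇔ (Sat-ren ρ φ ρ-e)
  Sat-ren ρ (and φ ψ) ρ-e = Sat-ren ρ φ ρ-e ×-⇔ Sat-ren ρ ψ ρ-e
  Sat-ren ρ (or φ ψ)  ρ-e = Sat-ren ρ φ ρ-e ⊎-⇔ Sat-ren ρ ψ ρ-e
  Sat-ren ρ (⋁ f)     ρ-e = Σ-cong-⇔ λ i → Sat-ren ρ (f i) ρ-e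
  Sat-ren ρ (⋀ f)     ρ-e = Π-cong-⇔ λ i → Sat-ren ρ (f i) ρ-e
  Sat-ren ρ (ex φ)    ρ-e = Σ-cong-⇔ λ a → Sat-ren (liftUnder 1 ρ) φ (∷ₑ-liftUnder a ρ-e)
  Sat-ren ρ (all φ)   ρ-e = Π-cong-⇔ λ a → Sat-ren (liftUnder 1 ρ) φ (∷ₑ-liftUnder a ρ-e)

  infixr 5 _∷ᴸ_ _++ₑ_

  _∷ᴸ_ : A → (Fin n → A) → Fin (suc n) → A
  _∷ᴸ_ = _∷ₑ_ L

  _++ₑ_ : ∀ {k} → (Fin k → A) → (Fin n → A) → Fin (k + n) → A
  _++ₑ_ {k = zero}  v e = e
  _++ₑ_ {k = suc k} v e = v fzero ∷ᴸ (v ∘ fsuc) ++ₑ e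

  ++ₑ-↑ˡ : ∀ {k} (v : Fin k → A) (e : Fin n → A) j → (v ++ₑ e) (j ↑ˡ n) ≡ v j
  ++ₑ-↑ˡ v e fzero    = refl
  ++ₑ-↑ˡ v e (fsuc j) = ++ₑ-↑ˡ (v ∘ fsuc) e j

  ++ₑ-↑ʳ : ∀ k (v : Fin k → A) (e : Fin n → A) i → (v ++ₑ e) (k ↑ʳ i) ≡ e i
  ++ₑ-↑ʳ zero    v e i = refl
  ++ₑ-↑ʳ (suc k) v e i = ++ₑ-↑ʳ k (v ∘ fsuc) e i

  Sat-exs : ∀ k (ψ : Formula (k + n)) (e : Fin n → A) →
            Sat L (exs k ψ) e ⇔ ∃ λ (v : Fin k → A) → Sat L ψ (v ++ₑ e)
  Sat-exs zero    ψ e = mk⇔ (λ s → (λ ()) , s) proj₂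
  Sat-exs (suc k) ψ e = mk⇔
    (λ s → let v , a , t = to (Sat-exs k (ex ψ) e) s in a ∷ᴸ v , t)
    (λ (v , t) → from (Sat-exs k (ex ψ) e) (v ∘ fsuc , v fzero , t))

  Sat-⋁∘ : {enum : ℕ → I} → StrictlySurjective _≡_ enum →
           (g : I → Formula n) (e : Fin n → A) → Sat L (⋁ (g ∘ enum)) e ⇔ ∃ λ x → Sat L (g x) e
  Sat-⋁∘ {enum = enum} enum-onto g e = mk⇔
    (λ (m , s) → enum m , s)
    (λ (x , s) → let m , m↦x = enum-onto x in m , subst (λ x → Sat L (g x) e) (sym m↦x) s)

  Sat-⋁ᶠ : (g : Fin n → Formula m) (e : Fin m → A) → Sat L (⋁ᶠ g) e ⇔ ∃ λ j → Sat L (g j) e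
  Sat-⋁ᶠ {zero}  g e = mk⇔ (λ ()) (λ ())
  Sat-⋁ᶠ {suc n} g e = ⊎⇔∃ ⇔-∘ (⇔-id _ ⊎-⇔ Sat-⋁ᶠ (g ∘ fsuc) e)

  Sat-between : ∀ (i j k : Fin n) e → Sat L (between i j k) e ⇔ Between L (e i) (e j) (e k)
  Sat-between i j k e = (Sat-leq ×-⇔ Sat-leq) ⊎-⇔ (Sat-leq ×-⇔ Sat-leq)
    where
    Sat-leq : ∀ {i j} → Sat L (leq i j) e ⇔ _≤ᴸ_ L (e i) (e j)
    Sat-leq = Lift-⇔ ⊎-⇔ Lift-⇔

  Sat-disjuncts : ∀ {γ} {φ : Formula n} (φ-Σ : IsΣ γ φ) e → Sat L φ e ⇔ ∃ λ i → Sat L (disjuncts φ-Σ i) e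
  Sat-disjuncts (Σ-qf _)  e = mk⇔ (0 ,_) proj₂
  Sat-disjuncts (Σ-⋁ _ _) e = ⇔-id _

-- Variables of Formula (suc (n + 2)): z, then witnesses v₀ … vₙ₋₁, then the endpoints x, y.
witness : Fin n → Fin (suc (n + 2))
witness j = fsuc (j ↑ˡ 2)

inInterval : ∀ n → Formula (suc (n + 2))
inInterval n = between (fsuc (n ↑ʳ fzero)) (fsuc (n ↑ʳ fsuc fzero)) fzero

atWitness : Fin n → Fin 2 → Fin (suc (n + 2))
atWitness j fzero    = fzero
atWitness j (fsuc _) = witness j

coveredBranch : ∀ n → (ℕ → Formula 2) → Fin (suc n) → ℕ → Formula (suc (n + 2))
coveredBranch n f fzero    _ = neg (inInterval n)
coveredBranch n f (fsuc j) i = ren (atWitness j) (f i)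

-- Flattening the disjunction over j of the disjunctions ⋁ f keeps covered within Σ_γ.
covered : IsΣ γ φ → ∀ n → Formula (suc (n + 2))
covered {φ = φ} (Σ-qf _) n = or (neg (inInterval n)) (⋁ᶠ λ j → ren (atWitness j) φ)
covered (Σ-⋁ f _) n        = ⋁ (uncurry (coveredBranch n f) ∘ enumFin×ℕ)

IsΣ-covered : (φ-Σ : IsΣ γ φ) → IsΣ γ (covered φ-Σ n)
IsΣ-covered (Σ-qf q) =
  Σ-qf (qf-or (qf-neg (QF-between _ _ _)) (QF-⋁ᶠ _ λ j → QF-ren (atWitness j) q))
IsΣ-covered {n = n} (Σ-⋁ f f-Σ) = Σ-⋁ _ (uncurry branch-ΣDisjunct ∘ enumFin×ℕ)
  where
  branch-ΣDisjunct : ∀ r i → ΣDisjunct _ (coveredBranch n f r i)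
  branch-ΣDisjunct fzero    _ = ΣDisjunct-qf (ΣDisjunct-positive (f-Σ 0)) (qf-neg (QF-between _ _ _))
  branch-ΣDisjunct (fsuc j) i = ΣDisjunct-ren (atWitness j) (f-Σ i)

-- The ∀z-clause is wrapped in a one-element ⋀ only because Π formulas are conjunctions.
successorFormula : IsΣ γ φ → Formula 2
successorFormula φ-Σ = ⋁ λ n → exs n (⋀ λ _ → all (covered φ-Σ n))

IsΣ-successorFormula : WF γ → (φ-Σ : IsΣ γ φ) → IsΣ (suc (suc γ)) (successorFormula φ-Σ)
IsΣ-successorFormula {γ} wfγ φ-Σ = Σ-⋁ _ λ n →
  n , _ , suc γ , refl , wf-suc wfγ , ≤ᵀ-refl _ ,
  Π-⋀ _ λ _ → 1 , covered φ-Σ n , γ , refl , wfγ , ≤ᵀ-refl _ , IsΣ-covered φ-Σ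

module SuccessorSemantics {c ℓ₁ ℓ₂} (L : StrictTotalOrder c ℓ₁ ℓ₂) where
  open StrictTotalOrder L renaming (Carrier to A)
  open Semantics L
  open EquationalReasoning {k = equivalence}

  covering⇔Sim-suc : ∀ {β} x y →
                     (∃ λ n → ∃ λ (v : Fin n → A) → ∀ z → Between L x y z → ∃ λ j → Sim L β z (v j)) ⇔
                     Sim L (suc β) x y
  covering⇔Sim-suc x y = mk⇔
    (λ (n , v , v-cover) → tabulate v , λ z z∈xy →
       let j , z∼vj = v-cover z z∈xy in tabulate⁺ j z∼vj)
    (λ (zs , zs-cover) → length zs , lookup zs , λ z z∈xy →
       let z∼w = zs-cover z z∈xy in index z∼w , lookup-index z∼w)

  module _ {n} (z : A) (v : Fin n → A) (x y : A) where
    private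
      e : Fin (suc (n + 2)) → A
      e = z ∷ᴸ v ++ₑ env₂ x y

    Sat-inInterval : Sat L (inInterval n) e ⇔ Between L x y z
    Sat-inInterval = subst₂ (λ x′ y′ → Sat L (inInterval n) e ⇔ Between L x′ y′ z)
      (++ₑ-↑ʳ n v (env₂ x y) fzero) (++ₑ-↑ʳ n v (env₂ x y) (fsuc fzero)) (Sat-between _ _ fzero e)

    Sat-atWitness : ∀ j φ → Sat L (ren (atWitness j) φ) e ⇔ Sat L φ (env₂ z (v j))
    Sat-atWitness j φ = Sat-ren (atWitness j) φ λ where
      fzero        → refl
      (fsuc fzero) → ++ₑ-↑ˡ v (env₂ x y) j

  Sat-covered : ∀ {γ φ n} (φ-Σ : IsΣ γ φ) (e : Fin (suc (n + 2)) → A) →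
                Sat L (covered φ-Σ n) e ⇔ (¬ Sat L (inInterval n) e ⊎ ∃ λ j → Sat L (ren (atWitness j) φ) e)
  Sat-covered (Σ-qf _) e = ⇔-id _ ⊎-⇔ Sat-⋁ᶠ _ e
  Sat-covered {n = n} (Σ-⋁ f _) e = mk⇔ regroup ungroup ⇔-∘ Sat-⋁∘ enumFin×ℕ-surjective _ e
    where
    regroup : ∃ (λ (r , i) → Sat L (coveredBranch n f r i) e) → _
    regroup ((fzero  , _) , s) = inj₁ s
    regroup ((fsuc j , i) , s) = inj₂ (j , i , s)
    ungroup : _ → ∃ (λ (r , i) → Sat L (coveredBranch n f r i) e)
    ungroup (inj₁ s)           = (fzero , 0) , s
    ungroup (inj₂ (j , i , s)) = (fsuc j , i) , s

  Sat-successorFormula : ExcludedMiddle (c ⊔ ℓ₁ ⊔ ℓ₂) → ∀ {β γ φ} (φ-Σ : IsΣ γ φ) →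
                         (∀ x y → Sat L φ (env₂ x y) ⇔ Sim L β x y) →
                         ∀ x y → Sat L (successorFormula φ-Σ) (env₂ x y) ⇔ Sim L (suc β) x y
  Sat-successorFormula em {β} {φ = φ} φ-Σ φ-defines x y = begin
    Sat L (successorFormula φ-Σ) (env₂ x y)
      ∼⟨ Σ-cong-⇔ (λ n → Sat-exs n _ (env₂ x y)) ⟩
    (∃ λ n → ∃ λ v → ℕ → ∀ z → Sat L (covered φ-Σ n) (z ∷ᴸ v ++ₑ env₂ x y))
      ∼⟨ Σ-cong-⇔ (λ n → Σ-cong-⇔ λ v → Π-cong-⇔ (clause v) ⇔-∘ mk⇔ (λ s → s 0) (λ s _ → s)) ⟩
    (∃ λ n → ∃ λ (v : Fin n → A) → ∀ z → Between L x y z → ∃ λ j → Sim L β z (v j))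
      ∼⟨ covering⇔Sim-suc x y ⟩
    Sim L (suc β) x y ∎
    where
    clause : ∀ {n} (v : Fin n → A) z →
             Sat L (covered φ-Σ n) (z ∷ᴸ v ++ₑ env₂ x y) ⇔ (Between L x y z → ∃ λ j → Sim L β z (v j))
    clause {n} v z = begin
      Sat L (covered φ-Σ n) e
        ∼⟨ Sat-covered φ-Σ e ⟩
      (¬ Sat L (inInterval n) e ⊎ ∃ λ j → Sat L (ren (atWitness j) φ) e)
        ∼⟨ ¬⊎⇔→ em ⟩
      (Sat L (inInterval n) e → ∃ λ j → Sat L (ren (atWitness j) φ) e)
        ∼⟨ →-cong-⇔ (Sat-inInterval z v x y) (Σ-cong-⇔ λ j → φ-defines z (v j) ⇔-∘ Sat-atWitness z v x y j φ) ⟩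
      (Between L x y z → ∃ λ j → Sim L β z (v j)) ∎
      where
      e = z ∷ᴸ v ++ₑ env₂ x y

limitFormula : ∀ {γs : ℕ → Tree} {φs : ℕ → Formula 2} → (∀ k → IsΣ (γs k) (φs k)) → Formula 2
limitFormula φs-Σ = ⋁ (uncurry (disjuncts ∘ φs-Σ) ∘ unpair)

IsΣ-limitFormula : ∀ {γs : ℕ → Tree} {φs : ℕ → Formula 2} → zero <ᵀ lim γs →
                   (φs-Σ : ∀ k → IsΣ (γs k) (φs k)) → IsΣ (lim γs) (limitFormula φs-Σ)
IsΣ-limitFormula 0<lim φs-Σ = Σ-⋁ _ λ m →
  let k , i = unpair m in disjuncts-ΣDisjunct 0<lim (≤-cocone k (≤ᵀ-refl _)) (φs-Σ k) i

module LimitSemantics {c ℓ₁ ℓ₂} (L : StrictTotalOrder c ℓ₁ ℓ₂) where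
  open Semantics L
  open EquationalReasoning {k = equivalence}

  Sat-limitFormula : ∀ {γs αs : ℕ → Tree} {φs : ℕ → Formula 2} (φs-Σ : ∀ k → IsΣ (γs k) (φs k)) →
                     (∀ k x y → Sat L (φs k) (env₂ x y) ⇔ Sim L (αs k) x y) →
                     ∀ x y → Sat L (limitFormula φs-Σ) (env₂ x y) ⇔ Sim L (lim αs) x y
  Sat-limitFormula {αs = αs} {φs} φs-Σ φs-define x y = begin
    Sat L (limitFormula φs-Σ) (env₂ x y)
      ∼⟨ Sat-⋁∘ unpair-surjective _ _ ⟩
    (∃ λ (k , i) → Sat L (disjuncts (φs-Σ k) i) (env₂ x y))
      ↔⟨ Σ-assoc ⟩
    (∃ λ k → ∃ λ i → Sat L (disjuncts (φs-Σ k) i) (env₂ x y))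
      ∼⟨ Σ-cong-⇔ (λ k → ⇔-sym (Sat-disjuncts (φs-Σ k) _)) ⟩
    (∃ λ k → Sat L (φs k) (env₂ x y))
      ∼⟨ Σ-cong-⇔ (λ k → φs-define k x y) ⟩
    Sim L (lim αs) x y ∎

equality-definable : DefinableBy zero zero
equality-definable = record
  { φ         = eq fzero (fsuc fzero)
  ; φ-is-Σ    = Σ-qf (qf-eq _ _)
  ; φ-defines = λ L _ x y → ⇔-id _
  }

successor-definable : ∀ {γ β} → WF γ → DefinableBy γ β → DefinableBy (suc (suc γ)) (suc β)
successor-definable wfγ D = record
  { φ         = successorFormula φ-is-Σ
  ; φ-is-Σ    = IsΣ-successorFormula wfγ φ-is-Σ
  ; φ-defines = λ L em → SuccessorSemantics.Sat-successorFormula L em φ-is-Σ (φ-defines L em)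
  }
  where open DefinableBy D

limit-definable : ∀ {γs αs : ℕ → Tree} → zero <ᵀ lim γs →
                  (∀ k → DefinableBy (γs k) (αs k)) → DefinableBy (lim γs) (lim αs)
limit-definable {γs} 0<lim Ds = record
  { φ         = limitFormula φs-Σ
  ; φ-is-Σ    = IsΣ-limitFormula 0<lim φs-Σ
  ; φ-defines = λ L em → LimitSemantics.Sat-limitFormula L φs-Σ λ k → DefinableBy.φ-defines (Ds k) L em
  }
  where
  φs-Σ : ∀ k → IsΣ (γs k) (DefinableBy.φ (Ds k))
  φs-Σ k = DefinableBy.φ-is-Σ (Ds k)

proposition1p6 : (α : Tree) → WF α → DefinableBy (double α) α
proposition1p6 zero    wf-zero           = equality-definable
proposition1p6 (suc α) (wf-suc wfα)      = successor-definable (WF-double wfα) (proposition1p6 α wfα)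
proposition1p6 (lim f) (wf-lim wf f-inc) =
  limit-definable (WF-lim-positive (WF-double (wf-lim wf f-inc))) λ k → proposition1p6 (f k) (wf k)
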